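{- Let $S=\{x_1,x_2,\ldots,x_m\}$ be a gcd-closed set of distinct positive integers with $m>5$. Let $x_n\in S$ be such that $G_S(x_n)=\{x_2,\ldots,x_{n-1}\}$, $\gcd(G_S(x_n))=x_1$ and $D_S(x_n)=\{x_1,x_{n+1},x_{n+2}\}$. If $x_i\mid x_n$ for all $n<i\le m$, then $(S)\nmid[S]$.
   Context: $S$ is gcd-closed if $\gcd(x,y)\in S$ for all $x,y\in S$. The GCD matrix $(S)$ is the $m\times m$ matrix with $(i,j)$-entry $\gcd(x_i,x_j)$; the LCM matrix $[S]$ has $(i,j)$-entry $\mathrm{lcm}(x_i,x_j)$. For $A,B\in M_m(\mathbb{Z})$, $A\mid B$ means there is $C\in M_m(\mathbb{Z})$ with $B=AC$ or $B=CA$; $A\nmid B$ otherwise. For $x<y$ in $S$, $x$ is a greatest-type divisor of $y$ in $S$ if $x\mid y$ and $x\mid z\mid y$, $z\in S$ imply $z\in\{x,y\}$; $G_S(y)$ is the set of greatest-type divisors of $y$ in $S$. If $G_S(x)=\{y_1,\ldots,y_k\}$, then $D_S(x)=\{\gcd(y_{i_1},\ldots,y_{i_r}): 2\le r\le k,\ 1\le i_1<\cdots<i_r\le k\}$. -}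

module Defs where

open import Data.Nat using (ℕ; zero; suc; _<_; _≤_)
open import Data.Nat.Divisibility using (_∣_)
open import Data.Nat.GCD using (gcd)
open import Data.Nat.LCM using (lcm)
open import Data.Integer as ℤ using (ℤ; +_)
open import Data.Fin using (Fin; toℕ)
open import Data.List using (List; length)
open import Data.List.Membership.Propositional using (_∈_)
open import Data.List.Relation.Unary.All using (All)
open import Data.List.Relation.Unary.Unique.Propositional using (Unique)
open import Data.Product using (Σ; ∃; _×_; _,_)
open import Data.Sum using (_⊎_)
open import Relation.Binary.PropositionalEquality using (_≡_)

-- The set S = {x 1, ..., x m}  (1-based indexing, as in the paper).
InS : ℕ → (ℕ → ℕ) → ℕ → Set
InS m x z = ∃ λ i → 1 ≤ i × i ≤ m × x i ≡ z

GcdClosed : (ℕ → Set) → Set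
GcdClosed S = ∀ a b → S a → S b → S (gcd a b)

GreatestTypeDivisor : (ℕ → Set) → ℕ → ℕ → Set
GreatestTypeDivisor S y z =
  S z × z < y × z ∣ y × (∀ w → S w → z ∣ w → w ∣ y → w ≡ z ⊎ w ≡ y)

IsGcdOf : (ℕ → Set) → ℕ → Set
IsGcdOf P d = (∀ z → P z → d ∣ z) × (∀ c → (∀ z → P z → c ∣ z) → c ∣ d)

-- z ∈ D_S(y): z is the gcd of r ≥ 2 distinct greatest-type divisors of y.
InD : (ℕ → Set) → ℕ → ℕ → Set
InD S y z = Σ (List ℕ) λ L →
  Unique L × 2 ≤ length L × All (GreatestTypeDivisor S y) L × IsGcdOf (_∈ L) z

Matrix : ℕ → Set
Matrix m = Fin m → Fin m → ℤ

sumFin : ∀ m → (Fin m → ℤ) → ℤ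
sumFin zero    f = + 0
sumFin (suc m) f = f Fin.zero ℤ.+ sumFin m (λ k → f (Fin.suc k))
  where import Data.Fin as Fin

_⊗_ : ∀ {m} → Matrix m → Matrix m → Matrix m
_⊗_ {m} A B i j = sumFin m (λ k → A i k ℤ.* B k j)

MatDivides : ∀ {m} → Matrix m → Matrix m → Set
MatDivides {m} A B =
  (∃ λ (C : Matrix m) → ∀ i j → B i j ≡ (A ⊗ C) i j)
  ⊎ (∃ λ (C : Matrix m) → ∀ i j → B i j ≡ (C ⊗ A) i j)

-- (S) and [S] for S = {x 1, ..., x m}; Fin index i corresponds to x (1 + i).
gcdMatrix : (m : ℕ) → (ℕ → ℕ) → Matrix m
gcdMatrix m x i j = + gcd (x (suc (toℕ i))) (x (suc (toℕ j)))

lcmMatrix : (m : ℕ) → (ℕ → ℕ) → Matrix m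
lcmMatrix m x i j = + lcm (x (suc (toℕ i))) (x (suc (toℕ j)))

module Submission where

-- Write N = x n, a = x (n+1), and let Y = {x 2, …, x (n-1)} be the
-- greatest-type divisors of N.  The inclusion–exclusion operator (incExc below)
--     Φ h = Σ_{T ⊆ Y} (-1)^|T| h (gcd (N , T))
-- is an integer linear functional on the rows of the GCD and LCM matrices.
-- It kills every row gcd (x k , -) with x k ≠ N (each such x k divides some
-- y ∈ Y, and the terms for T and T ∪ {y} cancel), and on row N it takes the
-- value α = Φ id.  Hence, if (S) ∣ [S] (on either side), Φ of row a of [S] is an
-- integer multiple of α (a general matrix criterion, proved first).  Counting
-- residues t mod N turns both Φ values into natural numbers:
--     α = #{t < N | N ∤ t y for all y ∈ Y},  l = #{t < N | N ∤ t lcm(a,y) for all y ∈ Y}.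
-- The hypotheses on D_S(x n) give lcm (a , y) ≠ N for y ∈ Y (so t = 1 is
-- counted in l, l > 0) and some y₀ ∈ Y with a ∤ y₀ (so t = N / lcm (a , y₀) is
-- counted in α but not in l, l < α).  A number strictly between 0 and α is no
-- integer multiple of α, which finishes the proof.

open import Defs
open import Data.Nat as ℕ
  using (ℕ; zero; suc; _+_; _*_; _∸_; _<_; _≤_; z≤n; s≤s; NonZero; _≟_)
import Data.Nat.Properties as ℕP
open import Data.Nat.Divisibility
open import Data.Nat.GCD
open import Data.Nat.LCM
open import Data.Integer as ℤ using (ℤ; +_)
import Data.Integer.Properties as ℤP
open import Data.Integer.Tactic.RingSolver using (solve-∀)
open import Data.Fin as Fin using (Fin; toℕ; fromℕ<)
import Data.Fin.Properties as FinP
open import Data.List using (List; []; _∷_; applyUpTo)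
open import Data.List.Membership.Propositional using (_∈_; find)
open import Data.List.Membership.Propositional.Properties using (∈-applyUpTo⁺; ∈-applyUpTo⁻)
open import Data.List.Relation.Unary.Any using (here; there)
open import Data.List.Relation.Unary.All as All using (All; []; _∷_)
open import Data.List.Relation.Unary.All.Properties using (¬All⇒Any¬)
open import Data.List.Relation.Unary.AllPairs using ([]; _∷_)
open import Data.Product using (∃; _×_; _,_; proj₁; proj₂)
open import Data.Sum using (_⊎_; inj₁; inj₂)
open import Data.Empty using (⊥; ⊥-elim)
open import Function.Bundles using (_⇔_; Equivalence)
open import Relation.Nullary using (¬_; Dec; yes; no)
open import Relation.Nullary.Decidable using (¬?; _×-dec_)
open import Relation.Binary.PropositionalEquality

open Equivalence using (to; from)

sumFin-ext : ∀ m {f g : Fin m → ℤ} → (∀ k → f k ≡ g k) → sumFin m f ≡ sumFin m g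
sumFin-ext zero    e = refl
sumFin-ext (suc m) e = cong₂ ℤ._+_ (e Fin.zero) (sumFin-ext m (λ k → e (Fin.suc k)))

sumFin-sub : ∀ m (p q : Fin m → ℤ) →
             sumFin m (λ k → p k ℤ.- q k) ≡ sumFin m p ℤ.- sumFin m q
sumFin-sub zero    p q = refl
sumFin-sub (suc m) p q = begin
  (p₀ ℤ.- q₀) ℤ.+ sumFin m (λ k → p (Fin.suc k) ℤ.- q (Fin.suc k))
    ≡⟨ cong (λ z → (p₀ ℤ.- q₀) ℤ.+ z) (sumFin-sub m (λ k → p (Fin.suc k)) (λ k → q (Fin.suc k))) ⟩
  (p₀ ℤ.- q₀) ℤ.+ (P ℤ.- Q)
    ≡⟨ interchange p₀ q₀ P Q ⟩
  (p₀ ℤ.+ P) ℤ.- (q₀ ℤ.+ Q) ∎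
  where
  open ≡-Reasoning
  p₀ = p Fin.zero
  q₀ = q Fin.zero
  P = sumFin m (λ k → p (Fin.suc k))
  Q = sumFin m (λ k → q (Fin.suc k))
  interchange : ∀ a b c d → (a ℤ.- b) ℤ.+ (c ℤ.- d) ≡ (a ℤ.+ c) ℤ.- (b ℤ.+ d)
  interchange = solve-∀

sumFin-zero : ∀ m (f : Fin m → ℤ) → (∀ k → f k ≡ + 0) → sumFin m f ≡ + 0
sumFin-zero zero    f e = refl
sumFin-zero (suc m) f e = cong₂ ℤ._+_ (e Fin.zero) (sumFin-zero m _ (λ k → e (Fin.suc k)))

sumFin-single : ∀ m (f : Fin m → ℤ) (k₀ : Fin m) →
                (∀ k → k ≢ k₀ → f k ≡ + 0) → sumFin m f ≡ f k₀
sumFin-single (suc m) f Fin.zero e =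
  trans (cong (λ z → f Fin.zero ℤ.+ z) (sumFin-zero m _ (λ k → e (Fin.suc k) (λ ()))))
        (ℤP.+-identityʳ _)
sumFin-single (suc m) f (Fin.suc k₀) e =
  trans (cong₂ ℤ._+_ (e Fin.zero (λ ()))
                     (sumFin-single m (λ k → f (Fin.suc k)) k₀
                        (λ k k≢k₀ → e (Fin.suc k) (λ eq → k≢k₀ (FinP.suc-injective eq)))))
        (ℤP.+-identityˡ _)

sumℕ : ℕ → (ℕ → ℕ) → ℕ
sumℕ zero    f = 0
sumℕ (suc n) f = f 0 + sumℕ n (λ t → f (suc t))

sumFin-ℕ : ∀ n (f : ℕ → ℕ) → sumFin n (λ k → + f (toℕ k)) ≡ + sumℕ n f
sumFin-ℕ zero    f = refl
sumFin-ℕ (suc n) f = trans (cong (λ z → + f 0 ℤ.+ z) (sumFin-ℕ n (λ t → f (suc t))))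
                           (sym (ℤP.pos-+ (f 0) _))

sumℕ-ext : ∀ n {f g : ℕ → ℕ} → (∀ t → f t ≡ g t) → sumℕ n f ≡ sumℕ n g
sumℕ-ext zero    e = refl
sumℕ-ext (suc n) e = cong₂ _+_ (e 0) (sumℕ-ext n (λ t → e (suc t)))

sumℕ-+ : ∀ p q f → sumℕ (p + q) f ≡ sumℕ p f + sumℕ q (λ t → f (p + t))
sumℕ-+ zero    q f = refl
sumℕ-+ (suc p) q f = trans (cong (λ z → f 0 + z) (sumℕ-+ p q (λ t → f (suc t))))
                           (sym (ℕP.+-assoc (f 0) _ _))

sumℕ-zero : ∀ n f → (∀ t → t < n → f t ≡ 0) → sumℕ n f ≡ 0
sumℕ-zero zero    f e = refl
sumℕ-zero (suc n) f e = cong₂ _+_ (e 0 (s≤s z≤n)) (sumℕ-zero n _ (λ t t<n → e (suc t) (s≤s t<n)))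

sumℕ-mono : ∀ n f g → (∀ t → f t ≤ g t) → sumℕ n f ≤ sumℕ n g
sumℕ-mono zero    f g le = z≤n
sumℕ-mono (suc n) f g le = ℕP.+-mono-≤ (le 0) (sumℕ-mono n _ _ (λ t → le (suc t)))

sumℕ-strict : ∀ n f g t₀ → (∀ t → f t ≤ g t) → t₀ < n → f t₀ < g t₀ → sumℕ n f < sumℕ n g
sumℕ-strict (suc n) f g zero     le _         lt =
  ℕP.+-mono-<-≤ lt (sumℕ-mono n _ _ (λ t → le (suc t)))
sumℕ-strict (suc n) f g (suc t₀) le (s≤s t₀<n) lt =
  ℕP.+-mono-≤-< (le 0) (sumℕ-strict n _ _ t₀ (λ t → le (suc t)) t₀<n lt)

term≤sumℕ : ∀ n f t₀ → t₀ < n → f t₀ ≤ sumℕ n f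
term≤sumℕ (suc n) f zero     _          = ℕP.m≤m+n (f 0) _
term≤sumℕ (suc n) f (suc t₀) (s≤s t₀<n) = ℕP.≤-trans (term≤sumℕ n _ t₀ t₀<n) (ℕP.m≤n+m _ (f 0))

ind : ∀ {A : Set} → Dec A → ℕ
ind (yes _) = 1
ind (no _)  = 0

ind-yes : ∀ {A : Set} (d : Dec A) → A → ind d ≡ 1
ind-yes (yes _) _ = refl
ind-yes (no ¬a) a = ⊥-elim (¬a a)

ind-no : ∀ {A : Set} (d : Dec A) → ¬ A → ind d ≡ 0
ind-no (yes a) ¬a = ⊥-elim (¬a a)
ind-no (no _)  _  = refl

ind-iff : ∀ {A B : Set} (dA : Dec A) (dB : Dec B) → (A → B) → (B → A) → ind dA ≡ ind dB
ind-iff (yes _) (yes _) _ _ = refl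
ind-iff (yes a) (no ¬b) f _ = ⊥-elim (¬b (f a))
ind-iff (no ¬a) (yes b) _ g = ⊥-elim (¬a (g b))
ind-iff (no _)  (no _)  _ _ = refl

multiples-in-period : ∀ q → 0 < q → sumℕ q (λ t → ind (q ∣? t)) ≡ 1
multiples-in-period (suc q) _ rewrite ind-yes (suc q ∣? 0) (divides 0 refl) =
  cong suc (sumℕ-zero q _ (λ t t<q →
    ind-no (suc q ∣? suc t) (λ d → ℕP.<⇒≱ (s≤s t<q) (∣⇒≤ d))))

count-multiples : ∀ q k → 0 < q → sumℕ (q * k) (λ t → ind (q ∣? t)) ≡ k
count-multiples q zero    q>0 rewrite ℕP.*-zeroʳ q = refl
count-multiples q (suc k) q>0
  rewrite ℕP.*-suc q k | sumℕ-+ q (q * k) (λ t → ind (q ∣? t)) | multiples-in-period q q>0 =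
  cong suc (trans (sumℕ-ext (q * k) (λ t → ind-iff (q ∣? (q + t)) (q ∣? t)
                     (λ d → ∣m+n∣m⇒∣n d ∣-refl) (λ d → ∣m∣n⇒∣m+n ∣-refl d)))
                  (count-multiples q k q>0))

-- If w ∣ N then  #{t < N | N ∣ t w} = w :  writing N = q w, this is #{t < q w | q ∣ t}.
count-solutions : ∀ N w → 0 < N → w ∣ N → sumℕ N (λ t → ind (N ∣? t * w)) ≡ w
count-solutions .(q * zero) zero N>0 (divides q refl) rewrite ℕP.*-zeroʳ q = ⊥-elim (ℕP.<-irrefl refl N>0)
count-solutions .(q * suc w) (suc w) N>0 (divides q refl) =
  trans (sumℕ-ext (q * suc w) (λ t → ind-iff (q * suc w ∣? t * suc w) (q ∣? t)
           (*-cancelʳ-∣ (suc w)) (*-monoˡ-∣ (suc w))))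
        (count-multiples q (suc w) (q>0 q N>0))
  where
  q>0 : ∀ q → 0 < q * suc w → 0 < q
  q>0 (suc _) _ = s≤s z≤n

-- The inclusion–exclusion operator over a list ys of "blocking" values:
--   incExc h ys g = Σ_{T ⊆ ys} (-1)^|T| h (gcd (g , T)).

incExc : (ℕ → ℤ) → List ℕ → ℕ → ℤ
incExc h []       g = h g
incExc h (y ∷ ys) g = incExc h ys g ℤ.- incExc h ys (gcd g y)

incExc-ext : ∀ {h h′} → (∀ v → h v ≡ h′ v) → ∀ ys g → incExc h ys g ≡ incExc h′ ys g
incExc-ext e []       g = e g
incExc-ext e (y ∷ ys) g = cong₂ ℤ._-_ (incExc-ext e ys g) (incExc-ext e ys (gcd g y))

-- incExc only evaluates h on gcds of g with elements of ys; so h may be changed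
-- freely outside any set I containing g and closed under gcd with elements of ys.
incExc-cong-on : ∀ {I J : ℕ → Set} → (∀ v y → I v → J y → I (gcd v y)) →
                 ∀ {h h′} → (∀ v → I v → h v ≡ h′ v) →
                 ∀ ys → All J ys → ∀ g → I g → incExc h ys g ≡ incExc h′ ys g
incExc-cong-on closed e []       _          g g∈I = e g g∈I
incExc-cong-on closed e (y ∷ ys) (y∈J ∷ js) g g∈I =
  cong₂ ℤ._-_ (incExc-cong-on closed e ys js g g∈I)
              (incExc-cong-on closed e ys js (gcd g y) (closed g y g∈I y∈J))

gcd-swap : ∀ g c y → gcd (gcd g c) y ≡ gcd (gcd g y) c
gcd-swap g c y = begin
  gcd (gcd g c) y ≡⟨ gcd-assoc g c y ⟩
  gcd g (gcd c y) ≡⟨ cong (gcd g) (gcd-comm c y) ⟩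
  gcd g (gcd y c) ≡⟨ gcd-assoc g y c ⟨
  gcd (gcd g y) c ∎
  where open ≡-Reasoning

incExc-invariant : ∀ {h c} → (∀ g → h (gcd g c) ≡ h g) →
                   ∀ ys g → incExc h ys (gcd g c) ≡ incExc h ys g
incExc-invariant inv []       g = inv g
incExc-invariant {h} {c} inv (y ∷ ys) g =
  cong₂ ℤ._-_ (incExc-invariant inv ys g)
              (trans (cong (incExc h ys) (gcd-swap g c y)) (incExc-invariant inv ys (gcd g y)))

-- If h is insensitive to taking gcd with some c ∈ ys, the subsets T and T ∪ {c}
-- cancel in pairs and incExc h ys vanishes.
incExc-vanish : ∀ {h c} → (∀ g → h (gcd g c) ≡ h g) → ∀ ys → c ∈ ys → ∀ g → incExc h ys g ≡ + 0
incExc-vanish {h} inv (y ∷ ys) (here refl) g =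
  trans (cong (λ z → incExc h ys g ℤ.- z) (incExc-invariant inv ys g)) (ℤP.+-inverseʳ (incExc h ys g))
incExc-vanish inv (y ∷ ys) (there c∈ys) g =
  cong₂ ℤ._-_ (incExc-vanish inv ys c∈ys g) (incExc-vanish inv ys c∈ys (gcd g y))

incExc-sumFin : ∀ m (f : Fin m → ℕ → ℤ) ys g →
  incExc (λ v → sumFin m (λ k → f k v)) ys g ≡ sumFin m (λ k → incExc (f k) ys g)
incExc-sumFin m f []       g = refl
incExc-sumFin m f (y ∷ ys) g =
  trans (cong₂ ℤ._-_ (incExc-sumFin m f ys g) (incExc-sumFin m f ys (gcd g y)))
        (sym (sumFin-sub m _ _))

incExc-scale : ∀ c h ys g → incExc (λ v → c ℤ.* h v) ys g ≡ c ℤ.* incExc h ys g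
incExc-scale c h []       g = refl
incExc-scale c h (y ∷ ys) g =
  trans (cong₂ ℤ._-_ (incExc-scale c h ys g) (incExc-scale c h ys (gcd g y)))
        (factor c (incExc h ys g) (incExc h ys (gcd g y)))
  where
  factor : ∀ a b c → a ℤ.* b ℤ.- a ℤ.* c ≡ a ℤ.* (b ℤ.- c)
  factor = solve-∀

avoids : ∀ {P : ℕ → Set} → (∀ v → Dec (P v)) → List ℕ → ℕ
avoids P? []       = 1
avoids P? (y ∷ ys) with P? y
... | yes _ = 0
... | no _  = avoids P? ys

avoids-one : ∀ {P : ℕ → Set} (P? : ∀ v → Dec (P v)) ys → (∀ y → y ∈ ys → ¬ P y) → avoids P? ys ≡ 1
avoids-one P? []       h = refl
avoids-one P? (y ∷ ys) h with P? y
... | yes py = ⊥-elim (h y (here refl) py)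
... | no _   = avoids-one P? ys (λ z z∈ → h z (there z∈))

avoids-zero : ∀ {P : ℕ → Set} (P? : ∀ v → Dec (P v)) ys y → y ∈ ys → P y → avoids P? ys ≡ 0
avoids-zero P? (z ∷ ys) y y∈ py with P? z
... | yes _ = refl
avoids-zero P? (z ∷ ys) y (here refl) py | no ¬pz = ⊥-elim (¬pz py)
avoids-zero P? (z ∷ ys) y (there y∈) py | no _   = avoids-zero P? ys y y∈ py

avoids-mono : ∀ {P Q : ℕ → Set} (P? : ∀ v → Dec (P v)) (Q? : ∀ v → Dec (Q v)) →
              (∀ y → P y → Q y) → ∀ ys → avoids Q? ys ≤ avoids P? ys
avoids-mono P? Q? P⇒Q []       = s≤s z≤n
avoids-mono P? Q? P⇒Q (y ∷ ys) with P? y | Q? y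
... | yes _  | yes _  = z≤n
... | yes py | no ¬qy = ⊥-elim (¬qy (P⇒Q y py))
... | no _   | yes _  = z≤n
... | no _   | no _   = avoids-mono P? Q? P⇒Q ys

-- For a gcd-filter P (P (gcd v y) ⇔ P v × P y) inclusion–exclusion of the
-- indicator of P factorises: only the empty subset T survives.
incExc-filter : ∀ {P : ℕ → Set} (P? : ∀ v → Dec (P v)) →
  (∀ v y → P (gcd v y) → P v) → (∀ v y → P (gcd v y) → P y) → (∀ v y → P v → P y → P (gcd v y)) →
  ∀ ys g → incExc (λ v → + ind (P? v)) ys g ≡ + (ind (P? g) * avoids P? ys)
incExc-filter P? down₁ down₂ up [] g = cong +_ (sym (ℕP.*-identityʳ _))
incExc-filter {P} P? down₁ down₂ up (y ∷ ys) g
  rewrite incExc-filter P? down₁ down₂ up ys g | incExc-filter P? down₁ down₂ up ys (gcd g y)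
  with P? y
... | yes py with P? g
...   | yes pg rewrite ind-yes (P? (gcd g y)) (up g y pg py) = ℤP.+-inverseʳ (+ (1 * avoids P? ys))
...   | no ¬pg rewrite ind-no (P? (gcd g y)) (λ p → ¬pg (down₁ g y p)) = refl
incExc-filter {P} P? down₁ down₂ up (y ∷ ys) g | no ¬py
  rewrite ind-no (P? (gcd g y)) (λ p → ¬py (down₂ g y p)) = ℤP.+-identityʳ _

gcd-of-divisor : ∀ {z g} → z ∣ g → gcd z g ≡ z
gcd-of-divisor {z} {g} z∣g = ∣-antisym (gcd[m,n]∣m z g) (gcd-greatest ∣-refl z∣g)

lcm-of-divisor : ∀ {a y} → a ∣ y → lcm a y ≡ y
lcm-of-divisor {a} {y} a∣y = ∣-antisym (lcm-least a∣y ∣-refl) (n∣lcm[m,n] a y)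

lcm-quotient : ∀ a b .{{_ : NonZero a}} → ∃ λ b′ → lcm a b ≡ b′ * a × b′ * gcd a b ≡ b
lcm-quotient a b with m∣lcm[m,n] a b
... | divides b′ eq = b′ , eq , ℕP.*-cancelʳ-≡ (b′ * gcd a b) b a (begin
    b′ * gcd a b * a   ≡⟨ ℕP.*-assoc b′ (gcd a b) a ⟩
    b′ * (gcd a b * a) ≡⟨ cong (b′ *_) (ℕP.*-comm (gcd a b) a) ⟩
    b′ * (a * gcd a b) ≡⟨ ℕP.*-assoc b′ a (gcd a b) ⟨
    b′ * a * gcd a b   ≡⟨ cong (_* gcd a b) eq ⟨
    lcm a b * gcd a b  ≡⟨ ℕP.*-comm (lcm a b) (gcd a b) ⟩
    gcd a b * lcm a b  ≡⟨ gcd*lcm a b ⟩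
    a * b              ≡⟨ ℕP.*-comm a b ⟩
    b * a ∎)
  where open ≡-Reasoning

-- With lcm a b = a b′, lcm a c = a c′, f = gcd b′ c′ and e = gcd a (gcd b c), the
-- left side is a f, and f e divides both b = b′ gcd a b and c = c′ gcd a c.
lcm-gcd-distrib : ∀ a b c → gcd (lcm a b) (lcm a c) ∣ lcm a (gcd b c)
lcm-gcd-distrib zero b c rewrite lcm[0,n]≡0 b | lcm[0,n]≡0 c = ∣-refl
lcm-gcd-distrib a@(suc _) zero c rewrite lcm[n,0]≡0 a =
  ∣-reflexive (trans (gcd-identityˡ _) (cong (lcm a) (sym (gcd-identityˡ c))))
lcm-gcd-distrib a@(suc _) b@(suc _) zero rewrite lcm[n,0]≡0 a =
  ∣-reflexive (trans (gcd-identityʳ _) (cong (lcm a) (sym (gcd-identityʳ b))))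
lcm-gcd-distrib a@(suc _) b@(suc _) c@(suc _)
  with lcm-quotient a b | lcm-quotient a c
... | b′ , lcm≡b′a , b′g≡b | c′ , lcm≡c′a , c′g≡c =
  ∣-trans (∣-reflexive lhs≡af) (*-cancelʳ-∣ e afe∣lcm·e)
  where
  d = gcd b c
  e = gcd a d
  f = gcd b′ c′
  instance
    e≢0 : NonZero e
    e≢0 = ℕ.≢-nonZero (gcd[m,n]≢0 a d (inj₁ (λ ())))
  fe∣b : f * e ∣ b
  fe∣b = ∣-trans (*-pres-∣ (gcd[m,n]∣m b′ c′)
                   (gcd-greatest (gcd[m,n]∣m a d) (∣-trans (gcd[m,n]∣n a d) (gcd[m,n]∣m b c))))
                 (∣-reflexive b′g≡b)
  fe∣c : f * e ∣ c
  fe∣c = ∣-trans (*-pres-∣ (gcd[m,n]∣n b′ c′)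
                   (gcd-greatest (gcd[m,n]∣m a d) (∣-trans (gcd[m,n]∣n a d) (gcd[m,n]∣n b c))))
                 (∣-reflexive c′g≡c)
  afe∣lcm·e : a * f * e ∣ lcm a d * e
  afe∣lcm·e = ∣-trans (∣-reflexive (ℕP.*-assoc a f e))
                (∣-trans (*-monoʳ-∣ a (gcd-greatest fe∣b fe∣c))
                  (∣-reflexive (trans (sym (gcd*lcm a d)) (ℕP.*-comm e (lcm a d)))))
  lhs≡af : gcd (lcm a b) (lcm a c) ≡ a * f
  lhs≡af = trans (cong₂ gcd (trans lcm≡b′a (ℕP.*-comm b′ a)) (trans lcm≡c′a (ℕP.*-comm c′ a)))
                 (sym (c*gcd[m,n]≡gcd[cm,cn] a b′ c′))

Symmetric : ∀ {m} → Matrix m → Set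
Symmetric {m} A = ∀ (i j : Fin m) → A i j ≡ A j i

record LinearFunctional (m : ℕ) : Set where
  field
    apply : (Fin m → ℤ) → ℤ
    apply-ext : ∀ {f g : Fin m → ℤ} → (∀ j → f j ≡ g j) → apply f ≡ apply g
    apply-combination : ∀ (c : Fin m → ℤ) (f : Fin m → Fin m → ℤ) →
      apply (λ j → sumFin m (λ k → c k ℤ.* f k j)) ≡ sumFin m (λ k → c k ℤ.* apply (f k))

open LinearFunctional

apply-rows : ∀ {m} (T : LinearFunctional m) (A : Matrix m) (k₀ : Fin m) {α : ℤ} →
  (∀ k → k ≢ k₀ → apply T (A k) ≡ + 0) → apply T (A k₀) ≡ α →
  ∀ (c : Fin m → ℤ) → apply T (λ j → sumFin m (λ k → c k ℤ.* A k j)) ≡ c k₀ ℤ.* α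
apply-rows {m} T A k₀ {α} kills top c = begin
  apply T (λ j → sumFin m (λ k → c k ℤ.* A k j)) ≡⟨ apply-combination T c A ⟩
  sumFin m (λ k → c k ℤ.* apply T (A k))
    ≡⟨ sumFin-single m _ k₀ (λ k k≢k₀ → trans (cong (c k ℤ.*_) (kills k k≢k₀)) (ℤP.*-zeroʳ (c k))) ⟩
  c k₀ ℤ.* apply T (A k₀)                         ≡⟨ cong (c k₀ ℤ.*_) top ⟩
  c k₀ ℤ.* α ∎
  where open ≡-Reasoning

not-multiple : ∀ {l α : ℕ} (c : ℤ) → 0 < l → l < α → + l ≢ c ℤ.* + α
not-multiple {l} {α} c l>0 l<α eq with ℤ.∣ c ∣ | trans (cong ℤ.∣_∣ eq) (ℤP.abs-* c (+ α))
... | zero  | l≡0    = ℕP.<-irrefl (sym l≡0) l>0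
... | suc k | l≡k′α = ℕP.<⇒≱ l<α (subst (α ≤_) (sym l≡k′α) (ℕP.m≤m+n α (k * α)))

-- If A ∣ B on either side, then T(row i of B) is an integer
-- multiple of α; so a row with 0 < T(row) < α shows A ∤ B.
nonDivisibility-criterion : ∀ {m} (A B : Matrix m) (T : LinearFunctional m) (k₀ i₀ : Fin m) {α l : ℕ} →
  Symmetric A → Symmetric B →
  (∀ k → k ≢ k₀ → apply T (A k) ≡ + 0) → apply T (A k₀) ≡ + α →
  apply T (B i₀) ≡ + l → 0 < l → l < α → ¬ MatDivides A B
nonDivisibility-criterion {m} A B T k₀ i₀ {α} {l} symA symB kills top row l>0 l<α (inj₂ (C , B≡CA)) =
  not-multiple (C i₀ k₀) l>0 l<α (begin
    + l                                                ≡⟨ row ⟨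
    apply T (B i₀)                                     ≡⟨ apply-ext T (B≡CA i₀) ⟩
    apply T (λ j → sumFin m (λ k → C i₀ k ℤ.* A k j)) ≡⟨ apply-rows T A k₀ kills top (C i₀) ⟩
    C i₀ k₀ ℤ.* + α ∎)
  where open ≡-Reasoning
nonDivisibility-criterion {m} A B T k₀ i₀ {α} {l} symA symB kills top row l>0 l<α (inj₁ (C , B≡AC)) =
  not-multiple (C k₀ i₀) l>0 l<α (begin
    + l                                                ≡⟨ row ⟨
    apply T (B i₀)                                     ≡⟨ apply-ext T (λ j → trans (symB i₀ j) (B≡AC j i₀)) ⟩
    apply T (λ j → sumFin m (λ k → A j k ℤ.* C k i₀))
      ≡⟨ apply-ext T (λ j → sumFin-ext m (λ k → trans (ℤP.*-comm (A j k) (C k i₀)) (cong (C k i₀ ℤ.*_) (symA j k)))) ⟩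
    apply T (λ j → sumFin m (λ k → C k i₀ ℤ.* A k j)) ≡⟨ apply-rows T A k₀ kills top (λ k → C k i₀) ⟩
    C k₀ i₀ ℤ.* + α ∎)
  where open ≡-Reasoning

-- The setting of the theorem.
module Setting (m : ℕ) (x : ℕ → ℕ)
    (pos : ∀ i → 1 ≤ i → i ≤ m → 0 < x i)
    (inj : ∀ i j → 1 ≤ i → i ≤ m → 1 ≤ j → j ≤ m → x i ≡ x j → i ≡ j)
    (gc : GcdClosed (InS m x))
    (n : ℕ) (n≥1 : 1 ≤ n) (n+2≤m : n + 2 ≤ m)
    (gtd⇔ : ∀ z → GreatestTypeDivisor (InS m x) (x n) z ⇔ (∃ λ i → 2 ≤ i × i < n × x i ≡ z))
    (x₁gcd : IsGcdOf (GreatestTypeDivisor (InS m x) (x n)) (x 1))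
    (D⇔ : ∀ z → InD (InS m x) (x n) z ⇔ (z ≡ x 1 ⊎ z ≡ x (n + 1) ⊎ z ≡ x (n + 2)))
    (divn : ∀ i → n < i → i ≤ m → x i ∣ x n) where

  S : ℕ → Set
  S = InS m x

  N a b : ℕ
  N = x n
  a = x (n + 1)
  b = x (n + 2)

  GTD : ℕ → Set
  GTD = GreatestTypeDivisor S N

  n<n+1 : n < n + 1
  n<n+1 = subst (n <_) (ℕP.+-comm 1 n) (ℕP.n<1+n n)

  1≤n+1 : 1 ≤ n + 1
  1≤n+1 = ℕP.≤-trans n≥1 (ℕP.<⇒≤ n<n+1)

  n+1≤m : n + 1 ≤ m
  n+1≤m = ℕP.≤-trans (ℕP.+-monoʳ-≤ n (s≤s z≤n)) n+2≤m

  n≤m : n ≤ m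
  n≤m = ℕP.≤-trans (ℕP.<⇒≤ n<n+1) n+1≤m

  N>0 : 0 < N
  N>0 = pos n n≥1 n≤m

  instance
    N≢0 : NonZero N
    N≢0 = ℕ.>-nonZero N>0

  GTD-S : ∀ {y} → GTD y → S y
  GTD-S (y∈S , _) = y∈S

  GTD-< : ∀ {y} → GTD y → y < N
  GTD-< (_ , y<N , _) = y<N

  GTD-∣ : ∀ {y} → GTD y → y ∣ N
  GTD-∣ (_ , _ , y∣N , _) = y∣N

  antichain : ∀ {y y′} → GTD y → GTD y′ → y ∣ y′ → y ≡ y′
  antichain (_ , _ , _ , maximal) (y′∈S , y′<N , y′∣N , _) y∣y′ with maximal _ y′∈S y∣y′ y′∣N
  ... | inj₁ y′≡y = sym y′≡y
  ... | inj₂ y′≡N = ⊥-elim (ℕP.<-irrefl y′≡N y′<N)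

  ys : List ℕ
  ys = applyUpTo (λ t → x (2 + t)) (n ∸ 2)

  ys→GTD : ∀ {y} → y ∈ ys → GTD y
  ys→GTD y∈ys with ∈-applyUpTo⁻ (λ t → x (2 + t)) y∈ys
  ... | t , t<n∸2 , refl = from (gtd⇔ (x (2 + t))) (2 + t , ℕP.m≤m+n 2 t , shift n t<n∸2 , refl)
    where
    shift : ∀ n {t} → t < n ∸ 2 → 2 + t < n
    shift (suc (suc n)) t<n = s≤s (s≤s t<n)

  GTD→ys : ∀ {y} → GTD y → y ∈ ys
  GTD→ys gy with to (gtd⇔ _) gy
  ... | i , 2≤i , i<n , refl =
    subst (λ j → x j ∈ ys) (ℕP.m+[n∸m]≡n 2≤i) (∈-applyUpTo⁺ (λ t → x (2 + t)) (ℕP.∸-monoˡ-< i<n 2≤i))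

  -- Since a = x (n+1) ∈ D_S(N), a is the gcd of two distinct greatest-type divisors
  -- y₁, y₂ of N; in particular x 1 = gcd G_S(N) divides a.
  record CoverOfA : Set where
    field
      y₁ y₂ : ℕ
      gtd₁ : GTD y₁
      gtd₂ : GTD y₂
      y₁≢y₂ : y₁ ≢ y₂
      a∣y₁ : a ∣ y₁
      a∣y₂ : a ∣ y₂
      x₁∣a : x 1 ∣ a

  cover : CoverOfA
  cover with from (D⇔ a) (inj₂ (inj₁ refl))
  ... | (y₁ ∷ y₂ ∷ _) , ((y₁∉ ∷ _) , _ , gtds@(g₁ ∷ g₂ ∷ _) , (a∣L , a-greatest)) = record
    { y₁ = y₁ ; y₂ = y₂ ; gtd₁ = g₁ ; gtd₂ = g₂ ; y₁≢y₂ = All.head y₁∉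
    ; a∣y₁ = a∣L y₁ (here refl) ; a∣y₂ = a∣L y₂ (there (here refl))
    ; x₁∣a = a-greatest (x 1) (λ z z∈L → proj₁ x₁gcd z (All.lookup gtds z∈L)) }
  ... | [] , (_ , () , _)
  ... | (_ ∷ []) , (_ , s≤s () , _)

  open CoverOfA cover

  a∣N : a ∣ N
  a∣N = divn (n + 1) n<n+1 n+1≤m

  1<N : 1 < N
  1<N = ℕP.<-≤-trans (s≤s (pos (n + 1) 1≤n+1 n+1≤m))
          (ℕP.≤∧≢⇒< (∣⇒≤ a∣N) (λ a≡N → ℕP.<-irrefl (sym (inj (n + 1) n 1≤n+1 n+1≤m n≥1 n≤m a≡N)) n<n+1))

  x₁≢a : x 1 ≢ a
  x₁≢a x₁≡a = ℕP.<-irrefl (trans (inj 1 (n + 1) (s≤s z≤n) (ℕP.≤-trans n≥1 n≤m) 1≤n+1 n+1≤m x₁≡a)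
                                  (ℕP.+-comm n 1))
                          (s≤s n≥1)

  pair∈D : ∀ {y′ y} → GTD y′ → GTD y → y′ ≢ y → InD S N (gcd y′ y)
  pair∈D {y′} {y} gy′ gy y′≢y =
    (y′ ∷ y ∷ []) , ((y′≢y ∷ []) ∷ ([] ∷ [])) , s≤s (s≤s z≤n) , (gy′ ∷ gy ∷ []) ,
    (λ { z (here refl) → gcd[m,n]∣m y′ y ; z (there (here refl)) → gcd[m,n]∣n y′ y }) ,
    (λ c c∣L → gcd-greatest (c∣L y′ (here refl)) (c∣L y (there (here refl))))

  -- If a ∣ y′ ∣ N = lcm a y, then y′ = gcd (lcm a y′) (lcm a y) ∣ lcm a (gcd y′ y).
  ∣lcm-a-gcd : ∀ {y′ y} → a ∣ y′ → y′ ∣ N → lcm a y ≡ N → y′ ∣ lcm a (gcd y′ y)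
  ∣lcm-a-gcd {y′} {y} a∣y′ y′∣N lcm≡N =
    ∣-trans (gcd-greatest (∣-reflexive (sym (lcm-of-divisor a∣y′))) (subst (y′ ∣_) (sym lcm≡N) y′∣N))
            (lcm-gcd-distrib a y′ y)

  -- Suppose lcm a y = N with a ∤ y, and y′ is a greatest-type divisor above a.
  -- Then gcd y′ y ∈ D_S(N) = {x 1, a, b} is not a; so either y′ ∣ lcm a (x 1) = a,
  -- or b ∣ y′ ∣ lcm a b.
  lcm-a-cases : ∀ {y′ y} → GTD y′ → GTD y → a ∣ y′ → ¬ a ∣ y → lcm a y ≡ N →
                y′ ∣ a ⊎ (y′ ∣ lcm a b × b ∣ y′)
  lcm-a-cases {y′} {y} gy′ gy a∣y′ a∤y lcm≡N
    with to (D⇔ (gcd y′ y)) (pair∈D gy′ gy (λ y′≡y → a∤y (subst (a ∣_) y′≡y a∣y′)))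
  ... | inj₁ g≡x₁ = inj₁ (subst (y′ ∣_) lcm[a,x₁]≡a (∣lcm-a-gcd a∣y′ (GTD-∣ gy′) lcm≡N))
    where
    lcm[a,x₁]≡a : lcm a (gcd y′ y) ≡ a
    lcm[a,x₁]≡a = trans (cong (lcm a) g≡x₁) (trans (lcm-comm a (x 1)) (lcm-of-divisor x₁∣a))
  ... | inj₂ (inj₁ g≡a) = ⊥-elim (a∤y (subst (_∣ y) g≡a (gcd[m,n]∣n y′ y)))
  ... | inj₂ (inj₂ g≡b) = inj₂ (subst (λ g → y′ ∣ lcm a g) g≡b (∣lcm-a-gcd a∣y′ (GTD-∣ gy′) lcm≡N) ,
                               subst (_∣ y′) g≡b (gcd[m,n]∣m y′ y))

  lcm-a-GTD≢N : ∀ {y} → GTD y → lcm a y ≢ N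
  lcm-a-GTD≢N {y} gy lcm≡N with a ∣? y
  ... | yes a∣y = ℕP.<-irrefl (trans (sym (lcm-of-divisor a∣y)) lcm≡N) (GTD-< gy)
  ... | no a∤y with lcm-a-cases gtd₁ gy a∣y₁ a∤y lcm≡N | lcm-a-cases gtd₂ gy a∣y₂ a∤y lcm≡N
  ... | inj₁ y₁∣a | _ = y₁≢y₂ (antichain gtd₁ gtd₂ (∣-trans y₁∣a a∣y₂))
  ... | inj₂ _ | inj₁ y₂∣a = y₁≢y₂ (sym (antichain gtd₂ gtd₁ (∣-trans y₂∣a a∣y₁)))
  ... | inj₂ (y₁∣lcm , _) | inj₂ (_ , b∣y₂) = y₁≢y₂ (antichain gtd₁ gtd₂ (∣-trans y₁∣lcm (lcm-least a∣y₂ b∣y₂)))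

  -- Some greatest-type divisor y₀ of N is not a multiple of a: otherwise a ∣ x 1,
  -- and with x 1 ∣ a this contradicts x 1 ≠ a.
  GTD-not-above-a : ∃ λ y₀ → y₀ ∈ ys × ¬ a ∣ y₀
  GTD-not-above-a with All.all? (a ∣?_) ys
  ... | yes a∣ys = ⊥-elim (x₁≢a (∣-antisym x₁∣a (proj₂ x₁gcd a (λ z gz → All.lookup a∣ys (GTD→ys gz)))))
  ... | no ¬a∣ys = find (¬All⇒Any¬ (a ∣?_) ys ¬a∣ys)

  -- Every element of S divides N: x i for i > n by hypothesis, x 1 ∣ y₁ ∣ N, and
  -- x 2, …, x (n-1) are greatest-type divisors of N.
  divides-N : ∀ {z} → S z → z ∣ N
  divides-N (i , 1≤i , i≤m , refl) with n ℕ.<? i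
  ... | yes n<i = divn i n<i i≤m
  ... | no n≮i with i ≟ n
  ... | yes refl = ∣-refl
  ... | no i≢n with i ≟ 1
  ... | yes refl = ∣-trans (proj₁ x₁gcd y₁ gtd₁) (GTD-∣ gtd₁)
  ... | no i≢1 = GTD-∣ (from (gtd⇔ (x i))
                        (i , ℕP.≤∧≢⇒< 1≤i (λ 1≡i → i≢1 (sym 1≡i)) , ℕP.≤∧≢⇒< (ℕP.≮⇒≥ n≮i) i≢n , refl))

  num : Fin m → ℕ
  num k = suc (toℕ k)

  num∈S : ∀ k → S (x (num k))
  num∈S k = num k , s≤s z≤n , FinP.toℕ<n k , refl

  fin : ∀ i → 1 ≤ i → i ≤ m → ∃ λ (k : Fin m) → num k ≡ i
  fin (suc i) _ i<m = fromℕ< i<m , cong suc (FinP.toℕ-fromℕ< i<m)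

  kn ka : Fin m
  kn = proj₁ (fin n n≥1 n≤m)
  ka = proj₁ (fin (n + 1) 1≤n+1 n+1≤m)

  kn-num : num kn ≡ n
  kn-num = proj₂ (fin n n≥1 n≤m)

  ka-num : num ka ≡ n + 1
  ka-num = proj₂ (fin (n + 1) 1≤n+1 n+1≤m)

  x≢N : ∀ k → k ≢ kn → x (num k) ≢ N
  x≢N k k≢kn x≡N = k≢kn (FinP.toℕ-injective (ℕP.suc-injective
    (trans (inj (num k) n (s≤s z≤n) (FinP.toℕ<n k) n≥1 n≤m x≡N) (sym kn-num))))

  index : ℕ → Fin m
  index v with FinP.any? (λ k → x (num k) ≟ v)
  ... | yes (k , _) = k
  ... | no _        = kn

  index-correct : ∀ {v} → S v → x (num (index v)) ≡ v
  index-correct {v} v∈S with FinP.any? (λ k → x (num k) ≟ v)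
  ... | yes (k , x≡v) = x≡v
  ... | no none with v∈S
  ... | i , 1≤i , i≤m , refl with fin i 1≤i i≤m
  ... | k , refl = ⊥-elim (none (k , refl))

  Between : ℕ → Fin m → Set
  Between c k = c ∣ x (num k) × x (num k) ∣ N × x (num k) ≢ c × x (num k) ≢ N

  between? : ∀ c k → Dec (Between c k)
  between? c k = (c ∣? x (num k)) ×-dec (x (num k) ∣? N) ×-dec ¬? (x (num k) ≟ c) ×-dec ¬? (x (num k) ≟ N)

  -- A proper divisor c ∈ S of N lies below a greatest-type divisor: while some
  -- element of S lies strictly between c and N, move up to it (N ∸ c decreases).
  below-GTD : ∀ fuel {c} → S c → c ∣ N → c ≢ N → N ∸ c ≤ fuel → ∃ λ g → GTD g × c ∣ g
  below-GTD zero {c} _ c∣N c≢N N∸c≤0 =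
    ⊥-elim (ℕP.<⇒≱ (ℕP.≤∧≢⇒< (∣⇒≤ c∣N) c≢N) (ℕP.m∸n≡0⇒m≤n (ℕP.n≤0⇒n≡0 N∸c≤0)))
  below-GTD (suc fuel) {c} c∈S c∣N c≢N N∸c≤fuel with FinP.any? (between? c)
  ... | yes (k , c∣w , w∣N , w≢c , w≢N) with below-GTD fuel (num∈S k) w∣N w≢N smaller
    where
    instance
      w≢0 : NonZero (x (num k))
      w≢0 = ℕ.>-nonZero (pos (num k) (s≤s z≤n) (FinP.toℕ<n k))
    smaller : N ∸ x (num k) ≤ fuel
    smaller = ℕP.<⇒≤pred (ℕP.<-≤-trans
      (ℕP.∸-monoʳ-< (ℕP.≤∧≢⇒< (∣⇒≤ c∣w) (λ c≡w → w≢c (sym c≡w))) (∣⇒≤ w∣N)) N∸c≤fuel)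
  ... | g , gtd , w∣g = g , gtd , ∣-trans c∣w w∣g
  below-GTD (suc fuel) {c} c∈S c∣N c≢N _ | no nothing-between =
    c , (c∈S , ℕP.≤∧≢⇒< (∣⇒≤ c∣N) c≢N , c∣N , maximal) , ∣-refl
    where
    maximal : ∀ w → S w → c ∣ w → w ∣ N → w ≡ c ⊎ w ≡ N
    maximal w w∈S c∣w w∣N with w ≟ c | w ≟ N
    ... | yes w≡c | _        = inj₁ w≡c
    ... | no _    | yes w≡N  = inj₂ w≡N
    ... | no w≢c  | no w≢N with w∈S
    ... | i , 1≤i , i≤m , refl with fin i 1≤i i≤m
    ... | k , refl = ⊥-elim (nothing-between (k , c∣w , w∣N , w≢c , w≢N))

  below-ys : ∀ k → k ≢ kn → ∃ λ g → g ∈ ys × x (num k) ∣ g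
  below-ys k k≢kn with below-GTD N (num∈S k) (divides-N (num∈S k)) (x≢N k k≢kn) (ℕP.m∸n≤m N (x (num k)))
  ... | g , gtd , x∣g = g , GTD→ys gtd , x∣g

  -- The divisors of N in S: contains N and is closed under gcd with elements of S,
  -- so incExc over ys starting at N only sees values in it.
  DivS : ℕ → Set
  DivS v = S v × v ∣ N

  incExc-on-DivS : ∀ {h h′} → (∀ v → DivS v → h v ≡ h′ v) → incExc h ys N ≡ incExc h′ ys N
  incExc-on-DivS e =
    incExc-cong-on closed e ys (All.tabulate (λ y∈ys → GTD-S (ys→GTD y∈ys))) N ((n , n≥1 , n≤m , refl) , ∣-refl)
    where
    closed : ∀ v y → DivS v → S y → DivS (gcd v y)
    closed v y (v∈S , v∣N) y∈S = gc v y v∈S y∈S , ∣-trans (gcd[m,n]∣m v y) v∣N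

  -- The test functional: inclusion–exclusion over G_S(N), reading a vector at the
  -- positions of the values gcd (N , T).
  T : LinearFunctional m
  apply T f = incExc (λ v → f (index v)) ys N
  apply-ext T e = incExc-ext (λ v → e (index v)) ys N
  apply-combination T c f =
    trans (incExc-sumFin m (λ k v → c k ℤ.* f k (index v)) ys N)
          (sumFin-ext m (λ k → incExc-scale (c k) (λ v → f k (index v)) ys N))

  -- Rows of (S) other than row n are killed (incExc-vanish at some y ≥ x k).
  T-kills : ∀ k → k ≢ kn → apply T (gcdMatrix m x k) ≡ + 0
  T-kills k k≢kn with below-ys k k≢kn
  ... | g , g∈ys , z∣g =
      trans (incExc-on-DivS (λ v v∈ → cong (λ w → + gcd z w) (index-correct (proj₁ v∈))))
            (incExc-vanish absorbs ys g∈ys N)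
      where
      z = x (num k)
      absorbs : ∀ v → + gcd z (gcd v g) ≡ + gcd z v
      absorbs v = cong +_ (trans (sym (gcd-assoc z v g))
                          (trans (gcd-swap z v g) (cong (λ w → gcd w v) (gcd-of-divisor z∣g))))

  unblocked : (ℕ → ℕ) → ℕ → ℕ
  unblocked φ t = avoids (λ v → N ∣? t * φ v) ys

  -- For φ compatible with gcd, inclusion–exclusion of φ counts unblocked residues:
  -- φ v = #{t < N | N ∣ t φ v}, and "N ∣ t φ v" is a gcd-filter in v.
  incExc-count : (φ : ℕ → ℕ) → (∀ v → DivS v → φ v ∣ N) →
    (∀ v y → φ (gcd v y) ∣ φ v) → (∀ v y → φ (gcd v y) ∣ φ y) →
    (∀ v y → gcd (φ v) (φ y) ∣ φ (gcd v y)) → N ∣ φ N →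
    incExc (λ v → + φ v) ys N ≡ + sumℕ N (unblocked φ)
  incExc-count φ φ∣N mono₁ mono₂ meet N∣φN = begin
    incExc (λ v → + φ v) ys N
      ≡⟨ incExc-on-DivS (λ v v∈ → cong +_ (sym (count-solutions N (φ v) N>0 (φ∣N v v∈)))) ⟩
    incExc (λ v → + sumℕ N (λ t → ind (N ∣? t * φ v))) ys N
      ≡⟨ incExc-ext (λ v → sym (sumFin-ℕ N (λ t → ind (N ∣? t * φ v)))) ys N ⟩
    incExc (λ v → sumFin N (λ k → + ind (N ∣? toℕ k * φ v))) ys N
      ≡⟨ incExc-sumFin N (λ k v → + ind (N ∣? toℕ k * φ v)) ys N ⟩
    sumFin N (λ k → incExc (λ v → + ind (N ∣? toℕ k * φ v)) ys N)
      ≡⟨ sumFin-ext N (λ k → filter-term (toℕ k)) ⟩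
    sumFin N (λ k → + unblocked φ (toℕ k))
      ≡⟨ sumFin-ℕ N (unblocked φ) ⟩
    + sumℕ N (unblocked φ) ∎
    where
    open ≡-Reasoning
    filter-term : ∀ t → incExc (λ v → + ind (N ∣? t * φ v)) ys N ≡ + unblocked φ t
    filter-term t = trans
      (incExc-filter (λ v → N ∣? t * φ v)
        (λ v y N∣ → ∣-trans N∣ (*-monoʳ-∣ t (mono₁ v y)))
        (λ v y N∣ → ∣-trans N∣ (*-monoʳ-∣ t (mono₂ v y)))
        (λ v y N∣v N∣y → ∣-trans (gcd-greatest N∣v N∣y)
           (∣-trans (∣-reflexive (sym (c*gcd[m,n]≡gcd[cm,cn] t (φ v) (φ y)))) (*-monoʳ-∣ t (meet v y))))
        ys N)
      (cong +_ (trans (cong (_* unblocked φ t) (ind-yes (N ∣? t * φ N) (∣-trans N∣φN (n∣m*n t))))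
                      (ℕP.*-identityˡ _)))

  α l : ℕ
  α = sumℕ N (unblocked (λ v → v))
  l = sumℕ N (unblocked (lcm a))

  -- On row n of (S), gcd (N , v) = v for v ∣ N, so T gives α.
  T-top : apply T (gcdMatrix m x kn) ≡ + α
  T-top = trans (incExc-on-DivS (λ v v∈ → cong +_ (begin
                  gcd (x (num kn)) (x (num (index v))) ≡⟨ cong₂ gcd (cong x kn-num) (index-correct (proj₁ v∈)) ⟩
                  gcd N v                              ≡⟨ gcd-comm N v ⟩
                  gcd v N                              ≡⟨ gcd-of-divisor (proj₂ v∈) ⟩
                  v ∎)))
                (incExc-count (λ v → v) (λ v v∈ → proj₂ v∈) gcd[m,n]∣m gcd[m,n]∣n (λ _ _ → ∣-refl) ∣-refl)
    where open ≡-Reasoning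

  T-lcm : apply T (lcmMatrix m x ka) ≡ + l
  T-lcm = trans (incExc-on-DivS (λ v v∈ → cong +_ (cong₂ lcm (cong x ka-num) (index-correct (proj₁ v∈)))))
                (incExc-count (lcm a) (λ v v∈ → lcm-least a∣N (proj₂ v∈))
                   (λ v y → lcm-least (m∣lcm[m,n] a v) (∣-trans (gcd[m,n]∣m v y) (n∣lcm[m,n] a v)))
                   (λ v y → lcm-least (m∣lcm[m,n] a y) (∣-trans (gcd[m,n]∣n v y) (n∣lcm[m,n] a y)))
                   (lcm-gcd-distrib a)
                   (n∣lcm[m,n] a N))

  -- t = 1 is unblocked for lcm a, because lcm a y ≠ N for y ∈ G_S(N).
  l>0 : 0 < l
  l>0 = ℕP.<-≤-trans (subst (0 <_) (sym unblocked-1) (s≤s z≤n)) (term≤sumℕ N (unblocked (lcm a)) 1 1<N)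
    where
    unblocked-1 : unblocked (lcm a) 1 ≡ 1
    unblocked-1 = avoids-one _ ys (λ y y∈ys N∣ → lcm-a-GTD≢N (ys→GTD y∈ys)
      (∣-antisym (lcm-least a∣N (GTD-∣ (ys→GTD y∈ys))) (subst (N ∣_) (ℕP.*-identityˡ _) N∣)))

  -- With a ∤ y₀ and N = q · lcm a y₀, the residue q is blocked for lcm a (by y₀)
  -- but unblocked for the identity: N ∣ q y forces lcm a y₀ ∣ y, so y₀ ∣ y, y = y₀ and a ∣ y₀.
  separating-residue : ∃ λ q → q < N × unblocked (lcm a) q ≡ 0 × unblocked (λ v → v) q ≡ 1
  separating-residue with GTD-not-above-a
  ... | y₀ , y₀∈ys , a∤y₀ with lcm-least a∣N (GTD-∣ (ys→GTD y₀∈ys))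
  ... | divides q N≡qℓ = q , q<N , avoids-zero _ ys y₀ y₀∈ys (∣-reflexive N≡qℓ) , avoids-one _ ys unblocked-q
    where
    ℓ = lcm a y₀
    instance
      q≢0 : NonZero q
      q≢0 = ℕ.≢-nonZero (λ q≡0 → ℕP.<-irrefl (sym (trans N≡qℓ (cong (_* ℓ) q≡0))) N>0)
    ℓ>0 : 0 < ℓ
    ℓ>0 = ℕP.n≢0⇒n>0 (λ ℓ≡0 → ℕP.<-irrefl (sym (trans N≡qℓ (trans (cong (q *_) ℓ≡0) (ℕP.*-zeroʳ q)))) N>0)
    ℓ>1 : 1 < ℓ
    ℓ>1 = ℕP.≤∧≢⇒< ℓ>0 (λ 1≡ℓ → a∤y₀ (∣-trans (subst (a ∣_) (sym 1≡ℓ) (m∣lcm[m,n] a y₀)) (1∣ y₀)))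
    q<N : q < N
    q<N = subst (q <_) (sym N≡qℓ) (ℕP.m<m*n q ℓ ℓ>1)
    unblocked-q : ∀ y → y ∈ ys → ¬ N ∣ q * y
    unblocked-q y y∈ys N∣qy = a∤y₀ (subst (a ∣_) (sym y₀≡y) (∣-trans (m∣lcm[m,n] a y₀) ℓ∣y))
      where
      ℓ∣y : ℓ ∣ y
      ℓ∣y = *-cancelˡ-∣ q (subst (_∣ q * y) N≡qℓ N∣qy)
      y₀≡y : y₀ ≡ y
      y₀≡y = antichain (ys→GTD y₀∈ys) (ys→GTD y∈ys) (∣-trans (n∣lcm[m,n] a y₀) ℓ∣y)

  -- Termwise, unblocked (lcm a) ≤ unblocked id; the residue q is strict.
  l<α : l < α
  l<α with separating-residue
  ... | q , q<N , blocked , unblocked-id =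
    sumℕ-strict N _ _ q
      (λ t → avoids-mono (λ v → N ∣? t * v) (λ v → N ∣? t * lcm a v)
               (λ y N∣ty → ∣-trans N∣ty (*-monoʳ-∣ t (n∣lcm[m,n] a y))) ys)
      q<N (subst₂ _<_ (sym blocked) (sym unblocked-id) (s≤s z≤n))

theorem3p3 : (m : ℕ) (x : ℕ → ℕ) → 5 < m
    → (∀ i → 1 ≤ i → i ≤ m → 0 < x i)
    → (∀ i j → 1 ≤ i → i ≤ m → 1 ≤ j → j ≤ m → x i ≡ x j → i ≡ j)
    → GcdClosed (InS m x)
    → (n : ℕ) → 1 ≤ n → n + 2 ≤ m
    → (∀ z → GreatestTypeDivisor (InS m x) (x n) z ⇔ (∃ λ i → 2 ≤ i × i < n × x i ≡ z))
    → IsGcdOf (GreatestTypeDivisor (InS m x) (x n)) (x 1)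
    → (∀ z → InD (InS m x) (x n) z ⇔ (z ≡ x 1 ⊎ z ≡ x (n + 1) ⊎ z ≡ x (n + 2)))
    → (∀ i → n < i → i ≤ m → x i ∣ x n)
    → ¬ MatDivides (gcdMatrix m x) (lcmMatrix m x)
theorem3p3 m x _ pos inj gc n n≥1 n+2≤m gtd⇔ x₁gcd D⇔ divn =
  nonDivisibility-criterion (gcdMatrix m x) (lcmMatrix m x) T kn ka
    (λ i j → cong +_ (gcd-comm (x (num i)) (x (num j))))
    (λ i j → cong +_ (lcm-comm (x (num i)) (x (num j))))
    T-kills T-top T-lcm l>0 l<α
  where open Setting m x pos inj gc n n≥1 n+2≤m gtd⇔ x₁gcd D⇔ divn
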